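{- Let $S$ be a Steiner triple system of order $n\ge49$ on the point set $\{1,\dots,n\}$. Then there is a function $h:S\to\{1,\dots,n\}$ such that (1) $h(T)\in T$ for every block $T\in S$, and (2) for every $i\in\{1,\dots,n\}$, $|\{T\in S:h(T)=i\}|\ge4$.
   Context: A Steiner triple system (STS) of order $n$ is a collection $S$ of $3$-subsets (blocks) of $\{1,\dots,n\}$ such that every $2$-subset lies in exactly one block. -}

module Defs where

open import Data.Nat using (ℕ; _≤_)
open import Data.Fin using (Fin)
open import Data.Fin.Subset using (Subset; _∈_; ∣_∣)
open import Data.List using (List; length; lookup; filter; allFin)
open import Data.List.Relation.Unary.Unique.Propositional using (Unique)
open import Data.List.Relation.Unary.All using (All)
open import Data.Product using (_×_)
open import Relation.Binary.PropositionalEquality using (_≡_)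
open import Relation.Nullary using (¬_)
open import Data.Fin.Subset.Properties using (_∈?_)
open import Data.Fin.Properties using (_≟_)
open import Relation.Nullary.Decidable using (_×-dec_)

-- A block system on the point set Fin n (points 1..n are encoded as Fin n):
-- a duplicate-free list of subsets of Fin n.
-- Number of blocks of S containing both x and y.
countPair : {n : ℕ} → List (Subset n) → Fin n → Fin n → ℕ
countPair S x y = length (filter (λ T → (x ∈? T) ×-dec (y ∈? T)) S)

record IsSTS {n : ℕ} (S : List (Subset n)) : Set where
  field
    distinct  : Unique S
    triples   : All (λ T → ∣ T ∣ ≡ 3) S
    pairOnce  : (x y : Fin n) → ¬ (x ≡ y) → countPair S x y ≡ 1

preimageSize : {n : ℕ} (S : List (Subset n)) → (Fin (length S) → Fin n) → Fin n → ℕ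
preimageSize S h i = length (filter (λ k → h k ≟ i) (allFin (length S)))

{-# OPTIONS --safe #-}
module Submission where

-- Every point of a Steiner triple system of order n lies in (n − 1)/2 ≥ 24 blocks, so it
-- suffices to show: if every block has at most r points and every point lies in at least
-- r * c blocks, then each block can be assigned to one of its points so that every point
-- receives at least c blocks.
-- Start from any assignment h. If a point i receives fewer than c blocks, let R be the set of
-- points reachable from i, where x leads to z when x lies in a block assigned to z. If some
-- z in R receives more than c blocks, reassigning the blocks along a simple walk from i to z
-- raises the coverage Σₓ min (load x) c, which is bounded by n * c. Otherwise every block
-- meeting R is assigned into R, and double counting gives
--   r * c * ∣R∣ ≤ Σ_{x ∈ R} degree x ≤ r * Σ_{x ∈ R} load x < r * c * ∣R∣.

open import Defs
open import Data.Nat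
  using (ℕ; zero; suc; _+_; _*_; _∸_; _⊓_; _≤_; _<_; _<?_; z≤n; s≤s; s≤s⁻¹; NonZero)
open import Data.Nat.Properties hiding (_≟_)
open import Data.Nat.Induction using (<-wellFounded)
open import Data.Bool using (true; false; if_then_else_)
open import Data.Fin using (Fin; zero; suc; punchIn)
open import Data.Fin.Properties using (_≟_; any?; punchInᵢ≢i)
open import Data.Fin.Subset
  using (Subset; _∈_; _∉_; _⊆_; ∣_∣; Nonempty; ⁅_⁆; _∪_; _⊂_; _⊃_; outside; inside)
open import Data.Fin.Subset.Properties
  using (_∈?_; nonempty?; Empty-unique; ∣⊥∣≡0; p⊆p∪q; q⊆p∪q; x∈p∪q⁻; x∈⁅x⁆; x∈⁅y⁆⇒x≡y)
open import Data.Fin.Subset.Induction using (⊃-wellFounded)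
open import Induction.WellFounded using (Acc; acc)
open import Data.Vec using ([]; _∷_)
open import Data.Vec.Functional using (updateAt)
open import Data.Vec.Functional.Properties using (updateAt-updates; updateAt-minimal)
open import Data.List using (List; length; lookup; filter; tabulate)
open import Data.List.Properties using (tabulate-lookup)
import Data.List.Relation.Unary.All as All
open import Data.List.Membership.Propositional.Properties using (∈-lookup)
open import Data.Product using (Σ; ∃-syntax; _×_; _,_; proj₁; proj₂)
open import Data.Sum using (_⊎_; inj₁; inj₂)
open import Data.Empty using (⊥; ⊥-elim)
open import Data.Unit using (⊤; tt)
open import Function using (_∘_; const)
open import Relation.Nullary using (Dec; yes; no; ¬_; does)
open import Relation.Nullary.Decidable using (_×-dec_; ¬?; dec-true; dec-false; decidable-stable)
open import Relation.Unary using (Decidable)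
open import Relation.Binary.PropositionalEquality

open import Data.Nat.Solver using (module +-*-Solver)
open +-*-Solver using (solve; _:+_; _:*_; _:=_; con)
open import Algebra.Properties.CommutativeMonoid.Sum +-0-commutativeMonoid
  using (sum; sum-syntax; ∑-comm; sum-cong-≗; sum-remove; sum-replicate-zero)
open import Algebra.Properties.Semiring.Sum +-*-semiring using (*-distribˡ-sum)
open import Algebra.Properties.CommutativeSemigroup *-commutativeSemigroup using (x∙yz≈y∙xz)

-- Defined through `does`, so that 𝟙 computes under `Dec.map′` (e.g. 𝟙 (suc x ∈? s ∷ p)).
𝟙 : ∀ {a} {A : Set a} → Dec A → ℕ
𝟙 a? = if does a? then 1 else 0

𝟙-true : ∀ {a} {A : Set a} (a? : Dec A) → A → 𝟙 a? ≡ 1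
𝟙-true a? a = cong (λ b → if b then 1 else 0) (dec-true a? a)

𝟙-false : ∀ {a} {A : Set a} (a? : Dec A) → ¬ A → 𝟙 a? ≡ 0
𝟙-false a? ¬a = cong (λ b → if b then 1 else 0) (dec-false a? ¬a)

𝟙-×-dec : ∀ {a b} {A : Set a} {B : Set b} (a? : Dec A) (b? : Dec B) →
          𝟙 (a? ×-dec b?) ≡ 𝟙 a? * 𝟙 b?
𝟙-×-dec a? b? with does a? | does b?
... | true  | true  = refl
... | true  | false = refl
... | false | _     = refl

𝟙-idem : ∀ {a} {A : Set a} (a? : Dec A) → 𝟙 a? * 𝟙 a? ≡ 𝟙 a?
𝟙-idem a? with does a?
... | true  = refl
... | false = refl

𝟙*≤ : ∀ {a} {A : Set a} (a? : Dec A) m → 𝟙 a? * m ≤ m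
𝟙*≤ a? m with does a?
... | true  = ≤-reflexive (+-identityʳ m)
... | false = z≤n

sum-const : ∀ n c → ∑[ i < n ] c ≡ n * c
sum-const zero    c = refl
sum-const (suc n) c = cong (c +_) (sum-const n c)

sum-mono-≤ : ∀ {n} {f g : Fin n → ℕ} → (∀ i → f i ≤ g i) → sum f ≤ sum g
sum-mono-≤ {zero}  f≤g = z≤n
sum-mono-≤ {suc n} f≤g = +-mono-≤ (f≤g zero) (sum-mono-≤ (f≤g ∘ suc))

sum-mono-< : ∀ {n} {f g : Fin n → ℕ} (j : Fin n) → (∀ i → f i ≤ g i) → f j < g j →
             sum f < sum g
sum-mono-< zero    f≤g fj<gj = +-mono-<-≤ fj<gj (sum-mono-≤ (f≤g ∘ suc))
sum-mono-< (suc j) f≤g fj<gj = +-mono-≤-< (f≤g zero) (sum-mono-< j (f≤g ∘ suc) fj<gj)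

sum-update : ∀ {n} (f g : Fin n → ℕ) (j : Fin n) → (∀ i → i ≢ j → f i ≡ g i) →
             sum f + g j ≡ sum g + f j
sum-update {suc n} f g j f≡g = begin
  sum f + g j                        ≡⟨ cong (_+ g j) (sum-remove {i = j} f) ⟩
  f j + sum (f ∘ punchIn j) + g j    ≡⟨ cong (λ s → f j + s + g j) rest ⟩
  f j + sum (g ∘ punchIn j) + g j    ≡⟨ +-comm (f j + _) (g j) ⟩
  g j + (f j + sum (g ∘ punchIn j))  ≡⟨ cong (g j +_) (+-comm (f j) _) ⟩
  g j + (sum (g ∘ punchIn j) + f j)  ≡⟨ +-assoc (g j) _ (f j) ⟨
  g j + sum (g ∘ punchIn j) + f j    ≡⟨ cong (_+ f j) (sum-remove {i = j} g) ⟨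
  sum g + f j                        ∎
  where
  open ≡-Reasoning
  rest : sum (f ∘ punchIn j) ≡ sum (g ∘ punchIn j)
  rest = sum-cong-≗ (λ i → f≡g (punchIn j i) (punchInᵢ≢i j i))

∑-pointMass : ∀ {n} (f : Fin n → ℕ) (a : Fin n) → ∑[ x < n ] (f x * 𝟙 (a ≟ x)) ≡ f a
∑-pointMass {suc n} f zero = begin
  f zero * 1 + ∑[ x < n ] (f (suc x) * 0)
    ≡⟨ cong₂ _+_ (*-identityʳ (f zero)) (sum-cong-≗ (*-zeroʳ ∘ f ∘ suc)) ⟩
  f zero + ∑[ x < n ] 0
    ≡⟨ cong (f zero +_) (sum-replicate-zero n) ⟩
  f zero + 0
    ≡⟨ +-identityʳ (f zero) ⟩
  f zero ∎
  where open ≡-Reasoning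
∑-pointMass {suc n} f (suc a) = begin
  f zero * 0 + ∑[ x < n ] (f (suc x) * 𝟙 (a ≟ x))  ≡⟨ cong (f zero * 0 +_) (∑-pointMass (f ∘ suc) a) ⟩
  f zero * 0 + f (suc a)                           ≡⟨ cong (_+ f (suc a)) (*-zeroʳ (f zero)) ⟩
  f (suc a)                                        ∎
  where open ≡-Reasoning

∣p∣≡∑𝟙 : ∀ {n} (p : Subset n) → ∣ p ∣ ≡ ∑[ x < n ] 𝟙 (x ∈? p)
∣p∣≡∑𝟙 []            = refl
∣p∣≡∑𝟙 (inside  ∷ p) = cong suc (∣p∣≡∑𝟙 p)
∣p∣≡∑𝟙 (outside ∷ p) = ∣p∣≡∑𝟙 p

length-filter-tabulate : ∀ {a p} {A : Set a} {P : A → Set p} (P? : Decidable P) {m}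
                         (f : Fin m → A) →
                         length (filter P? (tabulate f)) ≡ ∑[ k < m ] 𝟙 (P? (f k))
length-filter-tabulate P? {zero}  f = refl
length-filter-tabulate P? {suc m} f with does (P? (f zero))
... | true  = cong suc (length-filter-tabulate P? (f ∘ suc))
... | false = length-filter-tabulate P? (f ∘ suc)

∣p∣≡1+m⇒Nonempty : ∀ {n m} (p : Subset n) → ∣ p ∣ ≡ suc m → Nonempty p
∣p∣≡1+m⇒Nonempty {n} p ∣p∣≡1+m = decidable-stable (nonempty? p) λ empty →
  0≢1+n (trans (sym (∣⊥∣≡0 n)) (trans (cong ∣_∣ (sym (Empty-unique empty))) ∣p∣≡1+m))

module BlockSystem {n b : ℕ} (B : Fin b → Subset n) where

  degree : Fin n → ℕ
  degree x = ∑[ k < b ] 𝟙 (x ∈? B k)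

  codegree : Fin n → Fin n → ℕ
  codegree x y = ∑[ k < b ] (𝟙 (x ∈? B k) * 𝟙 (y ∈? B k))

  codegree-diag : ∀ x → codegree x x ≡ degree x
  codegree-diag x = sum-cong-≗ (λ k → 𝟙-idem (x ∈? B k))

  ∑-codegree : ∀ x → ∑[ y < n ] codegree x y ≡ ∑[ k < b ] (𝟙 (x ∈? B k) * ∣ B k ∣)
  ∑-codegree x = begin
    ∑[ y < n ] ∑[ k < b ] (χ k * 𝟙 (y ∈? B k))
      ≡⟨ ∑-comm (λ y k → χ k * 𝟙 (y ∈? B k)) ⟩
    ∑[ k < b ] ∑[ y < n ] (χ k * 𝟙 (y ∈? B k))
      ≡⟨ sum-cong-≗ (λ k → *-distribˡ-sum (χ k) (λ y → 𝟙 (y ∈? B k))) ⟨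
    ∑[ k < b ] (χ k * ∑[ y < n ] 𝟙 (y ∈? B k))
      ≡⟨ sum-cong-≗ (λ k → cong (χ k *_) (∣p∣≡∑𝟙 (B k))) ⟨
    ∑[ k < b ] (χ k * ∣ B k ∣) ∎
    where
    open ≡-Reasoning
    χ : Fin b → ℕ
    χ k = 𝟙 (x ∈? B k)

  Assignment : Set
  Assignment = Fin b → Fin n

  Valid : Assignment → Set
  Valid h = ∀ k → h k ∈ B k

  load : Assignment → Fin n → ℕ
  load h x = ∑[ k < b ] 𝟙 (h k ≟ x)

  reassign : Assignment → Fin b → Fin n → Assignment
  reassign h k x = updateAt h k (const x)

  reassign-valid : ∀ {h k x} → Valid h → x ∈ B k → Valid (reassign h k x)
  reassign-valid {h} {k} vh x∈Bk j with j ≟ k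
  ... | yes refl = subst (_∈ B k) (sym (updateAt-updates k h)) x∈Bk
  ... | no  j≢k  = subst (_∈ B j) (sym (updateAt-minimal j k h j≢k)) (vh j)

  load-reassign : ∀ h k x z →
                  load (reassign h k x) z + 𝟙 (h k ≟ z) ≡ load h z + 𝟙 (x ≟ z)
  load-reassign h k x z =
    trans (sum-update (λ j → 𝟙 (reassign h k x j ≟ z)) (λ j → 𝟙 (h j ≟ z)) k
                      (λ j j≢k → cong (λ v → 𝟙 (v ≟ z)) (updateAt-minimal j k h j≢k)))
          (cong (λ v → load h z + 𝟙 (v ≟ z)) (updateAt-updates k h))

  module _ {h : Assignment} {k : Fin b} {x : Fin n} (x≢hk : x ≢ h k) where
    open ≡-Reasoning
    private h′ = reassign h k x

    load-reassign-gain : load h′ x ≡ suc (load h x)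
    load-reassign-gain = begin
      load h′ x                  ≡⟨ +-identityʳ _ ⟨
      load h′ x + 0              ≡⟨ cong (load h′ x +_) (𝟙-false (h k ≟ x) (x≢hk ∘ sym)) ⟨
      load h′ x + 𝟙 (h k ≟ x)    ≡⟨ load-reassign h k x x ⟩
      load h x + 𝟙 (x ≟ x)       ≡⟨ cong (load h x +_) (𝟙-true (x ≟ x) refl) ⟩
      load h x + 1               ≡⟨ +-comm (load h x) 1 ⟩
      suc (load h x)             ∎

    load-reassign-loss : suc (load h′ (h k)) ≡ load h (h k)
    load-reassign-loss = begin
      suc (load h′ (h k))              ≡⟨ +-comm 1 _ ⟩
      load h′ (h k) + 1                ≡⟨ cong (load h′ (h k) +_) (𝟙-true (h k ≟ h k) refl) ⟨
      load h′ (h k) + 𝟙 (h k ≟ h k)    ≡⟨ load-reassign h k x (h k) ⟩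
      load h (h k) + 𝟙 (x ≟ h k)       ≡⟨ cong (load h (h k) +_) (𝟙-false (x ≟ h k) x≢hk) ⟩
      load h (h k) + 0                 ≡⟨ +-identityʳ _ ⟩
      load h (h k)                     ∎

    load-reassign-other : ∀ {z} → z ≢ x → z ≢ h k → load h′ z ≡ load h z
    load-reassign-other {z} z≢x z≢hk = begin
      load h′ z                  ≡⟨ +-identityʳ _ ⟨
      load h′ z + 0              ≡⟨ cong (load h′ z +_) (𝟙-false (h k ≟ z) (z≢hk ∘ sym)) ⟨
      load h′ z + 𝟙 (h k ≟ z)    ≡⟨ load-reassign h k x z ⟩
      load h z + 𝟙 (x ≟ z)       ≡⟨ cong (load h z +_) (𝟙-false (x ≟ z) (z≢x ∘ sym)) ⟩
      load h z + 0               ≡⟨ +-identityʳ _ ⟩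
      load h z                   ∎

  coverage : ℕ → Assignment → ℕ
  coverage c h = ∑[ x < n ] (load h x ⊓ c)

  coverage-≤ : ∀ c h → coverage c h ≤ n * c
  coverage-≤ c h =
    ≤-trans (sum-mono-≤ (λ x → m⊓n≤n (load h x) c)) (≤-reflexive (sum-const n c))

  module _ {c : ℕ} {h : Assignment} {k : Fin b} {x : Fin n}
           (c<load-hk : c < load h (h k)) (x≢hk : x ≢ h k) where

    capped-load-reassign : ∀ z → load h z ⊓ c ≤ load (reassign h k x) z ⊓ c
    capped-load-reassign z with z ≟ x | z ≟ h k
    ... | yes refl | _ = ⊓-monoˡ-≤ c (subst (load h x ≤_) (sym (load-reassign-gain x≢hk)) (n≤1+n _))
    ... | no _ | yes refl = ≤-trans (m⊓n≤n _ c) (≤-reflexive (sym (m≥n⇒m⊓n≡n c≤load′)))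
      where
      c≤load′ : c ≤ load (reassign h k x) (h k)
      c≤load′ = s≤s⁻¹ (subst (c <_) (sym (load-reassign-loss x≢hk)) c<load-hk)
    ... | no z≢x | no z≢hk =
      ≤-reflexive (cong (_⊓ c) (sym (load-reassign-other x≢hk z≢x z≢hk)))

    coverage-reassign-≤ : coverage c h ≤ coverage c (reassign h k x)
    coverage-reassign-≤ = sum-mono-≤ capped-load-reassign

    coverage-reassign-< : load h x < c → coverage c h < coverage c (reassign h k x)
    coverage-reassign-< load-hx<c = sum-mono-< x capped-load-reassign
      (≤-<-trans (m⊓n≤m _ c) (subst (λ m → load h x < m ⊓ c) (sym (load-reassign-gain x≢hk))
                                    (⊓-pres-m< ≤-refl load-hx<c)))

  -- Walks do not mention an assignment (`Follows` relates the two), so that `augment`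
  -- can recurse on a walk after a block has been reassigned.
  data Walk (i : Fin n) : Fin n → Set where
    []   : Walk i i
    step : ∀ {x} → Walk i x → (k : Fin b) → x ∈ B k → (y : Fin n) → Walk i y

  _∈ᵥ_ : ∀ {i y} → Fin n → Walk i y → Set
  _∈ᵥ_ {i} z []   = z ≡ i
  z ∈ᵥ step w _ _ y = z ≡ y ⊎ z ∈ᵥ w

  end∈ᵥ : ∀ {i y} (w : Walk i y) → y ∈ᵥ w
  end∈ᵥ []             = refl
  end∈ᵥ (step _ _ _ _) = inj₁ refl

  Follows : ∀ {i y} → Assignment → Walk i y → Set
  Follows h []             = ⊤
  Follows h (step w k _ y) = h k ≡ y × Follows h w

  Simple : ∀ {i y} → Walk i y → Set
  Simple []              = ⊤
  Simple (step w _ _ y)  = ¬ y ∈ᵥ w × Simple w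

  follows-reassign : ∀ {h k x i y} (w : Walk i y) → Follows h w →
                     (∀ {z} → z ∈ᵥ w → z ≢ h k) → Follows (reassign h k x) w
  follows-reassign []                       _           _      = tt
  follows-reassign {h} {k} (step w j _ y) (hj≡y , fw) avoids =
    trans (updateAt-minimal j k h j≢k) hj≡y , follows-reassign w fw (avoids ∘ inj₂)
    where
    j≢k : j ≢ k
    j≢k refl = avoids (inj₁ refl) (sym hj≡y)

  ∉ᵥ⇒≢ : ∀ {i y z v} {w : Walk i y} → ¬ v ∈ᵥ w → z ∈ᵥ w → z ≢ v
  ∉ᵥ⇒≢ v∉w z∈w refl = v∉w z∈w

  -- Giving the last block of the walk to the point before it moves the surplus one step back
  -- towards i.
  augment : ∀ {c h i y} → Valid h → (w : Walk i y) → Follows h w → Simple w →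
            load h i < c → c < load h y → ∃[ h′ ] Valid h′ × coverage c h < coverage c h′
  augment vh [] _ _ load-i<c c<load-i = ⊥-elim (<-asym load-i<c c<load-i)
  augment {c} {h} {i} vh (step {x} w k x∈Bk _) (refl , fw) (hk∉w , sw) load-i<c c<load-hk
    with ∉ᵥ⇒≢ hk∉w (end∈ᵥ w) | load h x <? c
  ... | x≢hk | yes load-x<c =
    reassign h k x , reassign-valid vh x∈Bk , coverage-reassign-< c<load-hk x≢hk load-x<c
  ... | x≢hk | no load-x≮c
    with augment (reassign-valid vh x∈Bk) w (follows-reassign w fw (∉ᵥ⇒≢ hk∉w)) sw
                 load′-i<c c<load′-x
    where
    c≤load-x : c ≤ load h x
    c≤load-x = ≮⇒≥ load-x≮c
    i≢x : i ≢ x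
    i≢x refl = <⇒≱ load-i<c c≤load-x
    i≢hk : i ≢ h k
    i≢hk refl = <-asym load-i<c c<load-hk
    load′-i<c : load (reassign h k x) i < c
    load′-i<c = subst (_< c) (sym (load-reassign-other x≢hk i≢x i≢hk)) load-i<c
    c<load′-x : c < load (reassign h k x) x
    c<load′-x = subst (c <_) (sym (load-reassign-gain x≢hk)) (s≤s c≤load-x)
  ... | h″ , vh″ , cov′<cov″ =
    h″ , vh″ , ≤-<-trans (coverage-reassign-≤ c<load-hk x≢hk) cov′<cov″

  Closed : Assignment → Subset n → Set
  Closed h R = ∀ {k x} → x ∈ R → x ∈ B k → h k ∈ R

  _⊆ᵥ_ : ∀ {i y} → Walk i y → Subset n → Set
  w ⊆ᵥ R = ∀ {z} → z ∈ᵥ w → z ∈ R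

  WalkWithin : Assignment → Fin n → Subset n → Fin n → Set
  WalkWithin h i R x = Σ (Walk i x) λ w → Follows h w × Simple w × w ⊆ᵥ R

  walkWithin-⊆ : ∀ {h i R R′ x} → R ⊆ R′ → WalkWithin h i R x → WalkWithin h i R′ x
  walkWithin-⊆ R⊆R′ (w , fw , sw , w⊆R) = w , fw , sw , R⊆R′ ∘ w⊆R

  walkWithin-step : ∀ {h i R x k} → WalkWithin h i R x → x ∈ B k → h k ∉ R →
                    WalkWithin h i (R ∪ ⁅ h k ⁆) (h k)
  walkWithin-step {h} {R = R} {k = k} (w , fw , sw , w⊆R) x∈Bk hk∉R =
    step w k x∈Bk (h k) , (refl , fw) , (hk∉R ∘ w⊆R , sw) , within
    where
    within : step w k x∈Bk (h k) ⊆ᵥ (R ∪ ⁅ h k ⁆)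
    within (inj₁ refl) = q⊆p∪q R ⁅ h k ⁆ (x∈⁅x⁆ (h k))
    within (inj₂ z∈w)  = p⊆p∪q ⁅ h k ⁆ (w⊆R z∈w)

  record Explored (h : Assignment) (P : Fin n → Set) (i : Fin n) (R : Subset n) : Set where
    field
      start   : i ∈ R
      avoided : ∀ {x} → x ∈ R → ¬ P x
      reached : ∀ {x} → x ∈ R → WalkWithin h i R x

  explored-step : ∀ {h P i R x k} → Explored h P i R →
                  x ∈ R → x ∈ B k → h k ∉ R → ¬ P (h k) → Explored h P i (R ∪ ⁅ h k ⁆)
  explored-step {h} {P} {i} {R} {k = k} ex x∈R x∈Bk hk∉R ¬P-hk = record
    { start   = p⊆p∪q ⁅ h k ⁆ start
    ; avoided = avoided′
    ; reached = reached′
    }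
    where
    open Explored ex
    avoided′ : ∀ {z} → z ∈ R ∪ ⁅ h k ⁆ → ¬ P z
    avoided′ z∈R′ with x∈p∪q⁻ R ⁅ h k ⁆ z∈R′
    ... | inj₁ z∈R   = avoided z∈R
    ... | inj₂ z∈⁅hk⁆ with refl ← x∈⁅y⁆⇒x≡y (h k) z∈⁅hk⁆ = ¬P-hk
    reached′ : ∀ {z} → z ∈ R ∪ ⁅ h k ⁆ → WalkWithin h i (R ∪ ⁅ h k ⁆) z
    reached′ z∈R′ with x∈p∪q⁻ R ⁅ h k ⁆ z∈R′
    ... | inj₁ z∈R   = walkWithin-⊆ (p⊆p∪q ⁅ h k ⁆) (reached z∈R)
    ... | inj₂ z∈⁅hk⁆ with refl ← x∈⁅y⁆⇒x≡y (h k) z∈⁅hk⁆ =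
      walkWithin-step (reached x∈R) x∈Bk hk∉R

  WalkTo : Assignment → (Fin n → Set) → Fin n → Set
  WalkTo h P i = ∃[ y ] Σ (Walk i y) λ w → Follows h w × Simple w × P y

  ClosedAvoiding : Assignment → (Fin n → Set) → Fin n → Set
  ClosedAvoiding h P i = ∃[ R ] i ∈ R × Closed h R × (∀ {x} → x ∈ R → ¬ P x)

  explore : ∀ {h P i} → Decidable P → (R : Subset n) → Acc _⊃_ R → Explored h P i R →
            WalkTo h P i ⊎ ClosedAvoiding h P i
  explore {h} {P} {i} P? R (acc larger) ex
    with any? (λ k → any? (λ x → x ∈? R ×-dec x ∈? B k ×-dec ¬? (h k ∈? R)))
  ... | no ¬exit = inj₂ (R , start , closed , avoided)
    where
    open Explored ex
    closed : Closed h R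
    closed {k} {x} x∈R x∈Bk =
      decidable-stable (h k ∈? R) λ hk∉R → ¬exit (k , x , x∈R , x∈Bk , hk∉R)
  ... | yes (k , x , x∈R , x∈Bk , hk∉R) with P? (h k)
  ...   | yes P-hk with (w , fw , sw , _) ← walkWithin-step (Explored.reached ex x∈R) x∈Bk hk∉R =
    inj₁ (h k , w , fw , sw , P-hk)
  ...   | no ¬P-hk =
    explore P? (R ∪ ⁅ h k ⁆) (larger R⊂R′) (explored-step ex x∈R x∈Bk hk∉R ¬P-hk)
    where
    R⊂R′ : R ⊂ R ∪ ⁅ h k ⁆
    R⊂R′ = p⊆p∪q ⁅ h k ⁆ , h k , q⊆p∪q R ⁅ h k ⁆ (x∈⁅x⁆ (h k)) , hk∉R

  reach-or-closed : ∀ {h P} → Decidable P → (i : Fin n) → WalkTo h P i ⊎ ClosedAvoiding h P i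
  reach-or-closed {h} {P} P? i with P? i
  ... | yes P-i = inj₁ (i , [] , tt , tt , P-i)
  ... | no ¬P-i = explore P? ⁅ i ⁆ (⊃-wellFounded ⁅ i ⁆) record
    { start   = x∈⁅x⁆ i
    ; avoided = λ x∈⁅i⁆ → subst (¬_ ∘ P) (sym (x∈⁅y⁆⇒x≡y i x∈⁅i⁆)) ¬P-i
    ; reached = λ x∈⁅i⁆ →
        subst (WalkWithin h i ⁅ i ⁆) (sym (x∈⁅y⁆⇒x≡y i x∈⁅i⁆)) at-start
    }
    where
    at-start : WalkWithin h i ⁅ i ⁆ i
    at-start = [] , tt , tt , λ { refl → x∈⁅x⁆ i }

  module _ {h : Assignment} {R : Subset n} where
    private
      χ : Fin n → ℕ
      χ x = 𝟙 (x ∈? R)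

    ∑-load-∈ : ∑[ x < n ] (χ x * load h x) ≡ ∑[ k < b ] χ (h k)
    ∑-load-∈ = begin
      ∑[ x < n ] (χ x * ∑[ k < b ] 𝟙 (h k ≟ x))
        ≡⟨ sum-cong-≗ (λ x → *-distribˡ-sum (χ x) (λ k → 𝟙 (h k ≟ x))) ⟩
      ∑[ x < n ] ∑[ k < b ] (χ x * 𝟙 (h k ≟ x))
        ≡⟨ ∑-comm (λ x k → χ x * 𝟙 (h k ≟ x)) ⟩
      ∑[ k < b ] ∑[ x < n ] (χ x * 𝟙 (h k ≟ x))
        ≡⟨ sum-cong-≗ (λ k → ∑-pointMass χ (h k)) ⟩
      ∑[ k < b ] χ (h k) ∎
      where open ≡-Reasoning

    ∑-degree-∈ : ∀ {r} → (∀ k → ∣ B k ∣ ≤ r) → Closed h R →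
                 ∑[ x < n ] (χ x * degree x) ≤ r * ∑[ k < b ] χ (h k)
    ∑-degree-∈ {r} small closed = begin
      ∑[ x < n ] (χ x * ∑[ k < b ] 𝟙 (x ∈? B k))
        ≡⟨ sum-cong-≗ (λ x → *-distribˡ-sum (χ x) (λ k → 𝟙 (x ∈? B k))) ⟩
      ∑[ x < n ] ∑[ k < b ] (χ x * 𝟙 (x ∈? B k))
        ≡⟨ ∑-comm (λ x k → χ x * 𝟙 (x ∈? B k)) ⟩
      ∑[ k < b ] ∑[ x < n ] (χ x * 𝟙 (x ∈? B k))
        ≤⟨ sum-mono-≤ per-block ⟩
      ∑[ k < b ] (r * χ (h k))
        ≡⟨ *-distribˡ-sum r (χ ∘ h) ⟨
      r * ∑[ k < b ] χ (h k) ∎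
      where
      open ≤-Reasoning
      per-block : ∀ k → ∑[ x < n ] (χ x * 𝟙 (x ∈? B k)) ≤ r * χ (h k)
      per-block k with h k ∈? R
      ... | yes _ = begin
        ∑[ x < n ] (χ x * 𝟙 (x ∈? B k))  ≤⟨ sum-mono-≤ (λ x → 𝟙*≤ (x ∈? R) (𝟙 (x ∈? B k))) ⟩
        ∑[ x < n ] 𝟙 (x ∈? B k)          ≡⟨ ∣p∣≡∑𝟙 (B k) ⟨
        ∣ B k ∣                          ≤⟨ small k ⟩
        r                                ≡⟨ *-identityʳ r ⟨
        r * 1                            ∎
      ... | no hk∉R = begin
        ∑[ x < n ] (χ x * 𝟙 (x ∈? B k))  ≤⟨ sum-mono-≤ outside-R ⟩
        ∑[ x < n ] 0                     ≡⟨ sum-replicate-zero n ⟩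
        0                                ≡⟨ *-zeroʳ r ⟨
        r * 0                            ∎
        where
        outside-R : ∀ x → χ x * 𝟙 (x ∈? B k) ≤ 0
        outside-R x with x ∈? R | x ∈? B k
        ... | yes x∈R | yes x∈Bk = ⊥-elim (hk∉R (closed x∈R x∈Bk))
        ... | yes _   | no _     = z≤n
        ... | no _    | _        = z≤n

    no-deficient-closed-set : ∀ {r c i} .{{_ : NonZero r}} →
                              (∀ k → ∣ B k ∣ ≤ r) → (∀ x → r * c ≤ degree x) → Closed h R →
                              i ∈ R → load h i < c → (∀ {x} → x ∈ R → load h x ≤ c) → ⊥
    no-deficient-closed-set {r} {c} {i} small popular closed i∈R load-i<c saturated =
      <⇒≱ (*-monoʳ-< r ∑load<∑c) (begin
        r * ∑[ x < n ] (χ x * c)         ≡⟨ *-distribˡ-sum r (λ x → χ x * c) ⟩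
        ∑[ x < n ] (r * (χ x * c))       ≡⟨ sum-cong-≗ (λ x → x∙yz≈y∙xz r (χ x) c) ⟩
        ∑[ x < n ] (χ x * (r * c))       ≤⟨ sum-mono-≤ (λ x → *-monoʳ-≤ (χ x) (popular x)) ⟩
        ∑[ x < n ] (χ x * degree x)      ≤⟨ ∑-degree-∈ small closed ⟩
        r * ∑[ k < b ] χ (h k)           ≡⟨ cong (r *_) ∑-load-∈ ⟨
        r * ∑[ x < n ] (χ x * load h x)  ∎)
      where
      open ≤-Reasoning
      pointwise : ∀ x → χ x * load h x ≤ χ x * c
      pointwise x with x ∈? R
      ... | yes x∈R = *-monoʳ-≤ 1 (saturated x∈R)
      ... | no  _   = z≤n
      ∑load<∑c : ∑[ x < n ] (χ x * load h x) < ∑[ x < n ] (χ x * c)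
      ∑load<∑c = sum-mono-< i pointwise
        (subst (λ m → m * load h i < m * c) (sym (𝟙-true (i ∈? R) i∈R)) (*-monoʳ-< 1 load-i<c))

  balanced-assignment : ∀ r c .{{_ : NonZero r}} →
                        (∀ k → Nonempty (B k)) → (∀ k → ∣ B k ∣ ≤ r) → (∀ x → r * c ≤ degree x) →
                        ∃[ h ] Valid h × ∀ x → c ≤ load h x
  balanced-assignment r c nonempty small popular =
    improve (proj₁ ∘ nonempty) (proj₂ ∘ nonempty) (<-wellFounded _)
    where
    improve : ∀ h → Valid h → Acc _<_ (n * c ∸ coverage c h) →
              ∃[ h ] Valid h × ∀ x → c ≤ load h x
    improve h vh (acc smaller) with any? (λ i → load h i <? c)
    ... | no ¬deficient = h , vh , λ x → ≮⇒≥ (¬deficient ∘ (x ,_))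
    ... | yes (i , load-i<c) with reach-or-closed (λ y → c <? load h y) i
    ...   | inj₂ (R , i∈R , closed , saturated) =
      ⊥-elim (no-deficient-closed-set small popular closed i∈R load-i<c (≮⇒≥ ∘ saturated))
    ...   | inj₁ (y , w , fw , sw , c<load-y) with augment vh w fw sw load-i<c c<load-y
    ...     | h′ , vh′ , cov<cov′ =
      improve h′ vh′ (smaller (∸-monoʳ-< cov<cov′ (coverage-≤ c h′)))

module SteinerTripleSystem {n : ℕ} {S : List (Subset n)} (sts : IsSTS S) where
  open IsSTS sts
  open BlockSystem (lookup S)

  block-size : ∀ k → ∣ lookup S k ∣ ≡ 3
  block-size k = All.lookup triples (∈-lookup k)

  block-nonempty : ∀ k → Nonempty (lookup S k)
  block-nonempty k = ∣p∣≡1+m⇒Nonempty (lookup S k) (block-size k)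

  countPair≡codegree : ∀ x y → countPair S x y ≡ codegree x y
  countPair≡codegree x y = begin
    length (filter P? S)
      ≡⟨ cong (length ∘ filter P?) (tabulate-lookup S) ⟨
    length (filter P? (tabulate (lookup S)))
      ≡⟨ length-filter-tabulate P? (lookup S) ⟩
    ∑[ k < length S ] 𝟙 (P? (lookup S k))
      ≡⟨ sum-cong-≗ (λ k → 𝟙-×-dec (x ∈? lookup S k) (y ∈? lookup S k)) ⟩
    codegree x y ∎
    where
    open ≡-Reasoning
    P? : Decidable (λ T → x ∈ T × y ∈ T)
    P? T = (x ∈? T) ×-dec (y ∈? T)

  1+2*degree≡n : ∀ x → 1 + 2 * degree x ≡ n
  1+2*degree≡n x = +-cancelˡ-≡ (degree x) _ _ (begin
    degree x + (1 + 2 * degree x)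
      ≡⟨ solve 1 (λ d → d :+ (con 1 :+ con 2 :* d) := con 3 :* d :+ con 1) refl (degree x) ⟩
    3 * degree x + 1
      ≡⟨ cong (_+ 1) (trans (∑-codegree x) blocks-of-size-3) ⟨
    ∑[ y < n ] codegree x y + 1
      ≡⟨ sum-update (codegree x) (const 1) x pairs-once ⟩
    ∑[ y < n ] 1 + codegree x x
      ≡⟨ cong₂ _+_ (trans (sum-const n 1) (*-identityʳ n)) (codegree-diag x) ⟩
    n + degree x
      ≡⟨ +-comm n (degree x) ⟩
    degree x + n ∎)
    where
    open ≡-Reasoning
    blocks-of-size-3 : ∑[ k < length S ] (𝟙 (x ∈? lookup S k) * ∣ lookup S k ∣) ≡ 3 * degree x
    blocks-of-size-3 =
      trans (sum-cong-≗ λ k → trans (cong (χ k *_) (block-size k)) (*-comm (χ k) 3))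
            (sym (*-distribˡ-sum 3 χ))
      where
      χ : Fin (length S) → ℕ
      χ k = 𝟙 (x ∈? lookup S k)
    pairs-once : ∀ y → y ≢ x → codegree x y ≡ 1
    pairs-once y y≢x = trans (sym (countPair≡codegree x y)) (pairOnce x y (y≢x ∘ sym))

  24≤degree : 49 ≤ n → ∀ x → 24 ≤ degree x
  24≤degree 49≤n x = *-cancelˡ-≤ 2 (s≤s⁻¹ (subst (49 ≤_) (sym (1+2*degree≡n x)) 49≤n))

preimageSize≡load : ∀ {n} (S : List (Subset n)) h i →
                    preimageSize S h i ≡ BlockSystem.load (lookup S) h i
preimageSize≡load S h i = length-filter-tabulate (λ k → h k ≟ i) (λ k → k)

lemma5 : (n : ℕ) → 49 ≤ n → (S : List (Subset n)) → IsSTS S →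
    Σ (Fin (length S) → Fin n) λ h →
      ((k : Fin (length S)) → h k ∈ lookup S k) ×
      ((i : Fin n) → 4 ≤ preimageSize S h i)
lemma5 n 49≤n S sts =
  let h , valid , covered = balanced-assignment 3 4 block-nonempty (≤-reflexive ∘ block-size) popular
  in  h , valid , λ i → subst (4 ≤_) (sym (preimageSize≡load S h i)) (covered i)
  where
  open BlockSystem (lookup S)
  open SteinerTripleSystem sts
  popular : ∀ x → 3 * 4 ≤ degree x
  popular x = ≤-trans (m≤m+n 12 12) (24≤degree 49≤n x)
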